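{- Define the type translation $\mathtt{Prop}^{\sharp}=\mathtt{Prop}\to\mathtt{Prop}$, $\mathtt{int}^{\sharp}=\mathtt{int}$, $(\sigma\to\tau)^{\sharp}=\sigma^{\sharp}\to\tau^{\sharp}$, extended pointwise to type environments, and the formula translation $(\cdot)^{\natural}$ by: $(e_1\le e_2)^{\natural}=\lambda x^{\mathtt{Prop}}.(e_1\le e_2\land x)$; $x^{\natural}=x$; $(\lambda x^{\sigma}.\varphi)^{\natural}=\lambda x^{\sigma^\sharp}.\varphi^{\natural}$; $(\varphi_1\varphi_2)^{\natural}=\varphi_1^{\natural}\varphi_2^{\natural}$; $(\varphi\,e)^{\natural}=\varphi^{\natural}\,e$; $(\mu x^{\tau}.\varphi)^{\natural}=\mu x^{\tau^\sharp}.\varphi^{\natural}$; $(\varphi_1\lor\varphi_2)^{\natural}=\lambda x^{\mathtt{Prop}}.\varphi_1^{\natural}x\lor\varphi_2^{\natural}x$; $(\varphi_1\land\varphi_2)^{\natural}=\lambda x^{\mathtt{Prop}}.\varphi_1^{\natural}(\varphi_2^{\natural}x)$. If $\Gamma\vdash\varphi:\sigma$ in the simple type system of $\mu$HFL$_{\mathbb Z}$, then $\Gamma^{\sharp}\vdash\varphi^{\natural}:\sigma^{\sharp}$.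
   Context: $\mu$HFL$_{\mathbb Z}$: types $\sigma ::= \mathtt{int}\mid \tau$, $\tau ::= \mathtt{Prop}\mid \sigma\to\tau$; formulas $\varphi ::= x\mid \varphi_1\lor\varphi_2\mid\varphi_1\land\varphi_2\mid \mu x^{\tau}.\varphi\mid \varphi_1\varphi_2\mid \lambda x^{\sigma}.\varphi\mid \varphi\,e\mid e_1\le e_2$ with integer expressions $e::= n\mid x\mid e_1+e_2\mid e_1\times e_2$. Simple typing judgments $\Gamma\vdash\varphi:\sigma$: variables get their type from $\Gamma$; $\lor,\land$ take two $\mathtt{Prop}$ formulas to $\mathtt{Prop}$; $\mu x^\tau.\varphi:\tau$ if $\Gamma,x:\tau\vdash\varphi:\tau$; $\lambda x^\sigma.\varphi:\sigma\to\tau$ if $\Gamma,x:\sigma\vdash\varphi:\tau$; $\varphi_1\varphi_2:\tau$ if $\varphi_1:\tau_2\to\tau$ and $\varphi_2:\tau_2$; $\varphi\,e:\tau$ if $\varphi:\mathtt{int}\to\tau$ and $e:\mathtt{int}$; $e_1\le e_2:\mathtt{Prop}$ if $e_1,e_2:\mathtt{int}$; integer expressions have type $\mathtt{int}$. -}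

module Defs where

open import Data.Nat using (ℕ; suc; _⊔_)
open import Data.Integer using (ℤ)
open import Data.List using (List; []; _∷_; map)
open import Data.Product using (_×_; _,_)
open import Relation.Binary.PropositionalEquality using (_≡_)
open import Relation.Nullary using (¬_)

Var : Set
Var = ℕ

-- Types:  σ ::= int | τ ,  τ ::= Prop | σ → τ
mutual
  data SType : Set where
    int : SType
    ty  : PType → SType

  data PType : Set where
    Prop : PType
    _⇒_  : SType → PType → PType

infixr 5 _⇒_

data IExp : Set where
  num  : ℤ → IExp
  ivar : Var → IExp
  _⊕_  : IExp → IExp → IExp
  _⊗_  : IExp → IExp → IExp

data Fml : Set where
  var   : Var → Fml
  _∨ᶠ_  : Fml → Fml → Fml
  _∧ᶠ_  : Fml → Fml → Fml
  μ     : Var → PType → Fml → Fml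
  _·_   : Fml → Fml → Fml
  lam   : Var → SType → Fml → Fml
  _·ᵉ_  : Fml → IExp → Fml
  _≤ᶠ_  : IExp → IExp → Fml

-- Type environments (most recent binding first; shadowing allowed)
Env : Set
Env = List (Var × SType)

data _∋_∶_ : Env → Var → SType → Set where
  here  : ∀ {Γ x σ} → ((x , σ) ∷ Γ) ∋ x ∶ σ
  there : ∀ {Γ x y σ σ'} → ¬ (x ≡ y) → Γ ∋ x ∶ σ → ((y , σ') ∷ Γ) ∋ x ∶ σ

data _⊢ᵉ_ : Env → IExp → Set where
  t-num  : ∀ {Γ n} → Γ ⊢ᵉ num n
  t-ivar : ∀ {Γ x} → Γ ∋ x ∶ int → Γ ⊢ᵉ ivar x
  t-add  : ∀ {Γ e₁ e₂} → Γ ⊢ᵉ e₁ → Γ ⊢ᵉ e₂ → Γ ⊢ᵉ (e₁ ⊕ e₂)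
  t-mul  : ∀ {Γ e₁ e₂} → Γ ⊢ᵉ e₁ → Γ ⊢ᵉ e₂ → Γ ⊢ᵉ (e₁ ⊗ e₂)

prop : SType
prop = ty Prop

data _⊢_∶_ : Env → Fml → SType → Set where
  t-var : ∀ {Γ x σ} → Γ ∋ x ∶ σ → Γ ⊢ var x ∶ σ
  t-or  : ∀ {Γ φ₁ φ₂} → Γ ⊢ φ₁ ∶ prop → Γ ⊢ φ₂ ∶ prop → Γ ⊢ (φ₁ ∨ᶠ φ₂) ∶ prop
  t-and : ∀ {Γ φ₁ φ₂} → Γ ⊢ φ₁ ∶ prop → Γ ⊢ φ₂ ∶ prop → Γ ⊢ (φ₁ ∧ᶠ φ₂) ∶ prop
  t-mu  : ∀ {Γ x τ φ} → ((x , ty τ) ∷ Γ) ⊢ φ ∶ ty τ → Γ ⊢ μ x τ φ ∶ ty τ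
  t-lam : ∀ {Γ x σ τ φ} → ((x , σ) ∷ Γ) ⊢ φ ∶ ty τ → Γ ⊢ lam x σ φ ∶ ty (σ ⇒ τ)
  t-app : ∀ {Γ φ₁ φ₂ τ₂ τ} → Γ ⊢ φ₁ ∶ ty (ty τ₂ ⇒ τ) → Γ ⊢ φ₂ ∶ ty τ₂ → Γ ⊢ (φ₁ · φ₂) ∶ ty τ
  t-appᵉ : ∀ {Γ φ e τ} → Γ ⊢ φ ∶ ty (int ⇒ τ) → Γ ⊢ᵉ e → Γ ⊢ (φ ·ᵉ e) ∶ ty τ
  t-le  : ∀ {Γ e₁ e₂} → Γ ⊢ᵉ e₁ → Γ ⊢ᵉ e₂ → Γ ⊢ (e₁ ≤ᶠ e₂) ∶ prop

mutual
  _♯ˢ : SType → SType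
  int ♯ˢ = int
  ty τ ♯ˢ = ty (τ ♯ᵖ)

  _♯ᵖ : PType → PType
  Prop ♯ᵖ = ty Prop ⇒ Prop
  (σ ⇒ τ) ♯ᵖ = (σ ♯ˢ) ⇒ (τ ♯ᵖ)

_♯ᴱ : Env → Env
Γ ♯ᴱ = map (λ { (x , σ) → (x , σ ♯ˢ) }) Γ

-- Largest variable name occurring anywhere (free or bound) in a formula;
-- used to pick the fresh bound variable x of the translation.
maxVarᵉ : IExp → ℕ
maxVarᵉ (num _) = 0
maxVarᵉ (ivar x) = x
maxVarᵉ (e₁ ⊕ e₂) = maxVarᵉ e₁ ⊔ maxVarᵉ e₂
maxVarᵉ (e₁ ⊗ e₂) = maxVarᵉ e₁ ⊔ maxVarᵉ e₂

maxVar : Fml → ℕ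
maxVar (var x) = x
maxVar (φ₁ ∨ᶠ φ₂) = maxVar φ₁ ⊔ maxVar φ₂
maxVar (φ₁ ∧ᶠ φ₂) = maxVar φ₁ ⊔ maxVar φ₂
maxVar (μ x _ φ) = x ⊔ maxVar φ
maxVar (φ₁ · φ₂) = maxVar φ₁ ⊔ maxVar φ₂
maxVar (lam x _ φ) = x ⊔ maxVar φ
maxVar (φ ·ᵉ e) = maxVar φ ⊔ maxVarᵉ e
maxVar (e₁ ≤ᶠ e₂) = maxVarᵉ e₁ ⊔ maxVarᵉ e₂

-- Formula translation (·)♮ ; the λ-bound x^Prop is chosen fresh for the
-- source formula (hence for its translation, which uses the same names or
-- fresh ones larger than all source names).
_♮ : Fml → Fml
(e₁ ≤ᶠ e₂) ♮ = let x = suc (maxVarᵉ e₁ ⊔ maxVarᵉ e₂) in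
               lam x prop ((e₁ ≤ᶠ e₂) ∧ᶠ var x)
var x ♮ = var x
lam x σ φ ♮ = lam x (σ ♯ˢ) (φ ♮)
(φ₁ · φ₂) ♮ = (φ₁ ♮) · (φ₂ ♮)
(φ ·ᵉ e) ♮ = (φ ♮) ·ᵉ e
μ x τ φ ♮ = μ x (τ ♯ᵖ) (φ ♮)
(φ₁ ∨ᶠ φ₂) ♮ = let x = suc (maxVar φ₁ ⊔ maxVar φ₂) in
               lam x prop (((φ₁ ♮) · var x) ∨ᶠ ((φ₂ ♮) · var x))
(φ₁ ∧ᶠ φ₂) ♮ = let x = suc (maxVar φ₁ ⊔ maxVar φ₂) in
               lam x prop ((φ₁ ♮) · ((φ₂ ♮) · var x))

module Submission where

-- Apart from the new λx^Prop binders the translation only changes types.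
-- Each such x is chosen above every variable name of the source formula, so
-- binding it cannot shadow a variable the formula uses; the induction carries
-- this bound on names in the invariant Translates.

open import Defs
open import Data.Nat using (ℕ; suc; _⊔_; _≤_; s≤s)
open import Data.Nat.Properties using (≤-refl; ≤-trans; m≤m⊔n; m≤n⊔m; <⇒≢)
open import Data.Product using (_,_)
open import Data.List using (_∷_)

Translates : ℕ → Env → Env → Set
Translates n Γ Γ' = ∀ {y σ} → y ≤ n → Γ ∋ y ∶ σ → Γ' ∋ y ∶ (σ ♯ˢ)

translates-♯ᴱ : ∀ {Γ n} → Translates n Γ (Γ ♯ᴱ)
translates-♯ᴱ _ here         = here
translates-♯ᴱ _ (there y≢ p) = there y≢ (translates-♯ᴱ ≤-refl p)

translates-≤ : ∀ {m n Γ Γ'} → m ≤ n → Translates n Γ Γ' → Translates m Γ Γ'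
translates-≤ m≤n t y≤m = t (≤-trans y≤m m≤n)

translates-⊔ˡ : ∀ {m n Γ Γ'} → Translates (m ⊔ n) Γ Γ' → Translates m Γ Γ'
translates-⊔ˡ {m} {n} = translates-≤ (m≤m⊔n m n)

translates-⊔ʳ : ∀ {m n Γ Γ'} → Translates (m ⊔ n) Γ Γ' → Translates n Γ Γ'
translates-⊔ʳ {m} {n} = translates-≤ (m≤n⊔m m n)

translates-fresh : ∀ {n Γ Γ'} σ' → Translates n Γ Γ' → Translates n Γ ((suc n , σ') ∷ Γ')
translates-fresh _ t y≤n p = there (<⇒≢ (s≤s y≤n)) (t y≤n p)

translates-bind : ∀ {x n Γ Γ' σ} →
  Translates (x ⊔ n) Γ Γ' → Translates n ((x , σ) ∷ Γ) ((x , σ ♯ˢ) ∷ Γ')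
translates-bind t _   here         = here
translates-bind t y≤n (there y≢ p) = there y≢ (translates-⊔ʳ t y≤n p)

translate-⊢ᵉ : ∀ {Γ Γ' e} → Translates (maxVarᵉ e) Γ Γ' → Γ ⊢ᵉ e → Γ' ⊢ᵉ e
translate-⊢ᵉ t t-num         = t-num
translate-⊢ᵉ t (t-ivar p)    = t-ivar (t ≤-refl p)
translate-⊢ᵉ t (t-add d₁ d₂) = t-add (translate-⊢ᵉ (translates-⊔ˡ t) d₁) (translate-⊢ᵉ (translates-⊔ʳ t) d₂)
translate-⊢ᵉ t (t-mul d₁ d₂) = t-mul (translate-⊢ᵉ (translates-⊔ˡ t) d₁) (translate-⊢ᵉ (translates-⊔ʳ t) d₂)

♮-preserves-⊢ : ∀ {Γ Γ' φ σ} → Translates (maxVar φ) Γ Γ' → Γ ⊢ φ ∶ σ → Γ' ⊢ (φ ♮) ∶ (σ ♯ˢ)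
♮-preserves-⊢ t (t-var p)      = t-var (t ≤-refl p)
♮-preserves-⊢ t (t-or d₁ d₂)   =
  t-lam (t-or (t-app (♮-preserves-⊢ (translates-⊔ˡ t′) d₁) (t-var here))
              (t-app (♮-preserves-⊢ (translates-⊔ʳ t′) d₂) (t-var here)))
  where t′ = translates-fresh prop t
♮-preserves-⊢ t (t-and d₁ d₂)  =
  t-lam (t-app (♮-preserves-⊢ (translates-⊔ˡ t′) d₁)
               (t-app (♮-preserves-⊢ (translates-⊔ʳ t′) d₂) (t-var here)))
  where t′ = translates-fresh prop t
♮-preserves-⊢ t (t-mu d)       = t-mu (♮-preserves-⊢ (translates-bind t) d)
♮-preserves-⊢ t (t-lam d)      = t-lam (♮-preserves-⊢ (translates-bind t) d)
♮-preserves-⊢ t (t-app d₁ d₂)  = t-app (♮-preserves-⊢ (translates-⊔ˡ t) d₁) (♮-preserves-⊢ (translates-⊔ʳ t) d₂)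
♮-preserves-⊢ t (t-appᵉ d e)   = t-appᵉ (♮-preserves-⊢ (translates-⊔ˡ t) d) (translate-⊢ᵉ (translates-⊔ʳ t) e)
♮-preserves-⊢ t (t-le e₁ e₂)   =
  t-lam (t-and (t-le (translate-⊢ᵉ (translates-⊔ˡ t′) e₁) (translate-⊢ᵉ (translates-⊔ʳ t′) e₂))
               (t-var here))
  where t′ = translates-fresh prop t

lemma1 : ∀ {Γ φ σ} → Γ ⊢ φ ∶ σ → (Γ ♯ᴱ) ⊢ (φ ♮) ∶ (σ ♯ˢ)
lemma1 = ♮-preserves-⊢ translates-♯ᴱ
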